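{- Every graph $G$ with maximum degree $\Delta$ has a tree-decomposition $\mathcal{D}$ of width $\operatorname{tw}(G)$ such that for every bag $B$ of $\mathcal{D}$, either $G[B]$ has maximum degree at most $\Delta-1$ or $|B|\le \Delta+1$.
   Context: Graphs are finite and simple; $\operatorname{tw}$ denotes treewidth. -}

module Defs where

open import Data.Nat using (ℕ; zero; suc; _≤_; _+_; _⊔_)
open import Data.Bool using (Bool; true; false; if_then_else_; _∧_)
open import Data.Fin using (Fin)
open import Data.Vec using (Vec; lookup; allFin; replicate)
open import Data.Fin.Subset using (Subset; _∈_; ∣_∣; ⊤)
open import Data.List using (List; []; _∷_; _++_; [_]; length)
open import Data.List.Relation.Unary.Linked using (Linked)
open import Data.List.Relation.Unary.Unique.Propositional using (Unique)
open import Data.Product using (Σ; _×_; ∃; ∃-syntax)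
open import Relation.Nullary using (¬_)
open import Relation.Binary.PropositionalEquality using (_≡_)

record Graph (n : ℕ) : Set where
  field
    adj    : Fin n → Fin n → Bool
    sym    : ∀ u v → adj u v ≡ adj v u
    irrefl : ∀ v → adj v v ≡ false

open Graph public

Adj : ∀ {n} → Graph n → Fin n → Fin n → Set
Adj G u v = adj G u v ≡ true

countTrue : ∀ {k} → Vec Bool k → ℕ
countTrue Vec.[] = 0
countTrue (true Vec.∷ bs) = suc (countTrue bs)
countTrue (false Vec.∷ bs) = countTrue bs

degIn : ∀ {n} → Graph n → Subset n → Fin n → ℕ
degIn {n} G B v = countTrue (Data.Vec.map (λ u → adj G v u ∧ lookup B u) (allFin n))

deg : ∀ {n} → Graph n → Fin n → ℕ
deg G v = degIn G ⊤ v

-- maximum degree of G (0 for the graph with no vertices)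
maxDeg : ∀ {n} → Graph n → ℕ
maxDeg {n} G = Data.Vec.foldr (λ _ → ℕ) (λ v acc → deg G v ⊔ acc) 0 (allFin n)

InducedMaxDeg≤ : ∀ {n} → Graph n → Subset n → ℕ → Set
InducedMaxDeg≤ G B d = ∀ v → v ∈ B → degIn G B v ≤ d

data WalkIn {n : ℕ} (G : Graph n) (P : Fin n → Set) : Fin n → Fin n → Set where
  here : ∀ {x} → P x → WalkIn G P x x
  step : ∀ {x y z} → P x → Adj G x y → WalkIn G P y z → WalkIn G P x z

ConnectedOn : ∀ {n} → Graph n → (Fin n → Set) → Set
ConnectedOn G P = ∀ x y → P x → P y → WalkIn G P x y

Connected : ∀ {n} → Graph n → Set
Connected G = ConnectedOn G (λ _ → Data.Unit.⊤)
  where import Data.Unit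

record Cycle {n : ℕ} (G : Graph n) : Set where
  field
    start  : Fin n
    rest   : List (Fin n)
    long   : 2 ≤ length rest
    unique : Unique (start ∷ rest)
    linked : Linked (Adj G) (start ∷ rest ++ [ start ])

Acyclic : ∀ {n} → Graph n → Set
Acyclic G = ¬ Cycle G

IsTree : ∀ {m} → Graph m → Set
IsTree {m} T = 1 ≤ m × Connected T × Acyclic T

record TreeDecomposition {n : ℕ} (G : Graph n) : Set where
  field
    nodes   : ℕ
    tree    : Graph nodes
    isTree  : IsTree tree
    bag     : Fin nodes → Subset n
    covers  : ∀ v → ∃[ t ] v ∈ bag t
    edges   : ∀ u v → Adj G u v → ∃[ t ] (u ∈ bag t × v ∈ bag t)
    coherent : ∀ v → ConnectedOn tree (λ t → v ∈ bag t)

open TreeDecomposition public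

-- every bag of D has at most s vertices (i.e. width(D) ≤ s - 1)
BagsAtMost : ∀ {n} {G : Graph n} → TreeDecomposition G → ℕ → Set
BagsAtMost D s = ∀ t → ∣ bag D t ∣ ≤ s

-- s = tw(G) + 1, i.e. s is the least number such that G has a
-- tree-decomposition all of whose bags have at most s vertices.
IsTreewidthPlusOne : ∀ {n} → Graph n → ℕ → Set
IsTreewidthPlusOne G s =
  (∃[ D ] BagsAtMost {G = G} D s) ×
  (∀ (D : TreeDecomposition G) → ∃[ t ] s ≤ ∣ bag D t ∣)

-- G[B] has maximum degree at most d - 1 (stated as deg + 1 ≤ d so that
-- d = 0 correctly means "≤ -1", which fails for nonempty B)
InducedMaxDeg<  : ∀ {n} → Graph n → Subset n → ℕ → Set
InducedMaxDeg< G B d = ∀ v → v ∈ B → suc (degIn G B v) ≤ d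

{-# OPTIONS --safe #-}
-- Start from any optimal tree-decomposition D, call a vertex hosted if its closed
-- neighbourhood N[v] lies inside some bag, and pick a maximal independent set S of
-- hosted vertices. Delete S from every bag and, for each v ∈ S, hang a new leaf with
-- bag N[v] below a node whose bag contains N[v]. No bag grows, and as S is independent
-- each v ∈ S survives only in its own leaf, so this is again a tree-decomposition of
-- the same width. Leaf bags have at most Δ + 1 vertices. If some u had degree Δ in
-- G[B ─ S] for an old bag B, then N[u] ⊆ B ─ S: so u is hosted, yet neither u nor any
-- of its neighbours is in S, contradicting the maximality of S.

module Submission where

open import Defs
open import Data.Nat using (ℕ; suc; _≤_)
open import Data.Fin.Subset using (∣_∣)
open import Data.Product using (∃-syntax; _×_)
open import Data.Sum using (_⊎_)

open import Data.Bool using (Bool; true; false; _∧_)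
open import Data.Empty using (⊥-elim)
open import Data.Fin using (Fin; zero; suc; _↑ˡ_; _↑ʳ_; splitAt; fromℕ<)
open import Data.Fin.Properties using (_≟_; any?; splitAt-↑ˡ; splitAt-↑ʳ; splitAt⁻¹-↑ˡ; splitAt⁻¹-↑ʳ)
open import Data.Fin.Subset using (Subset; _∈_; _∉_; _⊆_; ⊤; ⊥; ⁅_⁆; _∪_; _∩_; _─_)
open import Data.Fin.Subset.Properties
  using ( _∈?_; _⊆?_; nonempty?; ∉⊥; ∣⁅x⁆∣≡1; p⊆q⇒∣p∣≤∣q∣; p⊂q⇒∣p∣<∣q∣; ⊆-trans; ∩-identityʳ
        ; x∈⁅x⁆; x∈⁅y⁆⇒x≡y; x∈p∩q⁺; p∩q⊆p; p∩q⊆q; x∈p∪q⁺; x∈p∪q⁻; q⊆p∪q; p─q⊆p; x∈p∧x∉q⇒x∈p─q )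
open import Data.List using (List; []; _∷_; _++_; [_])
import Data.List as List
open import Data.List.Properties using (length-map; map-++)
open import Data.List.Membership.Propositional using () renaming (_∈_ to _∈ₗ_)
open import Data.List.Membership.Propositional.Properties using (∈-allFin)
open import Data.List.Relation.Unary.All using (All; []; _∷_)
import Data.List.Relation.Unary.All as All
open import Data.List.Relation.Unary.AllPairs using ([]; _∷_)
import Data.List.Relation.Unary.AllPairs as AllPairs
import Data.List.Relation.Unary.AllPairs.Properties as AllPairs
open import Data.List.Relation.Unary.Any using (here; there)
open import Data.List.Relation.Unary.Linked using (Linked; _∷_)
import Data.List.Relation.Unary.Linked as Linked
import Data.List.Relation.Unary.Linked.Properties as Linked
open import Data.List.Relation.Unary.Unique.Propositional using (Unique)
open import Data.Nat using (_+_; _⊔_; z≤n; s≤s; s≤s⁻¹; _≤?_)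
open import Data.Nat.Properties
  using (≤-trans; ≤-reflexive; m≤m⊔n; m≤n⊔m; m≤m+n; n≤1+n; +-suc; +-monoʳ-≤; <⇒≱; ≰⇒>; module ≤-Reasoning)
open import Data.Product using (_,_; proj₁; proj₂)
import Data.Product as Product
open import Data.Sum using (inj₁; inj₂; [_,_]′)
import Data.Sum as Sum
open import Data.Unit using (tt)
open import Data.Vec using (Vec; []; _∷_; here; there; tabulate; lookup; foldr; allFin; map)
open import Data.Vec.Properties using (lookup∘tabulate; tabulate-allFin; lookup-allFin; []=⇒lookup; lookup⇒[]=)
import Data.Vec.Functional as Vector
open import Data.Vec.Functional.Properties using (lookup-++ˡ; lookup-++ʳ)
open import Function using (_∘_)
open import Relation.Binary using (Rel)
open import Relation.Binary.PropositionalEquality as ≡ using (_≡_; refl; trans; cong; cong₂; subst)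
open import Relation.Nullary using (¬_; yes; no; does; contradiction)
open import Relation.Nullary.Decidable using (dec-true)
open import Relation.Unary using (Decidable)

∈-tabulate⁺ : ∀ {n} {f : Fin n → Bool} {u} → f u ≡ true → u ∈ tabulate f
∈-tabulate⁺ {f = f} {u} fu = lookup⇒[]= u _ (trans (lookup∘tabulate f u) fu)

∈-tabulate⁻ : ∀ {n} {f : Fin n → Bool} {u} → u ∈ tabulate f → f u ≡ true
∈-tabulate⁻ {f = f} {u} u∈ = trans (≡.sym (lookup∘tabulate f u)) ([]=⇒lookup u∈)

tabulate-∧-lookup : ∀ {n} (f : Fin n → Bool) (p : Subset n) →
                    tabulate (λ u → f u ∧ lookup p u) ≡ tabulate f ∩ p
tabulate-∧-lookup f []      = refl
tabulate-∧-lookup f (b ∷ p) = cong (f zero ∧ b ∷_) (tabulate-∧-lookup (f ∘ suc) p)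

countTrue≡∣∣ : ∀ {n} (p : Subset n) → countTrue p ≡ ∣ p ∣
countTrue≡∣∣ []          = refl
countTrue≡∣∣ (true ∷ p)  = cong suc (countTrue≡∣∣ p)
countTrue≡∣∣ (false ∷ p) = countTrue≡∣∣ p

∣p∪q∣≤∣p∣+∣q∣ : ∀ {n} (p q : Subset n) → ∣ p ∪ q ∣ ≤ ∣ p ∣ + ∣ q ∣
∣p∪q∣≤∣p∣+∣q∣ []          []          = z≤n
∣p∪q∣≤∣p∣+∣q∣ (true ∷ p)  (true ∷ q)  = s≤s (≤-trans (∣p∪q∣≤∣p∣+∣q∣ p q) (+-monoʳ-≤ ∣ p ∣ (n≤1+n _)))
∣p∪q∣≤∣p∣+∣q∣ (true ∷ p)  (false ∷ q) = s≤s (∣p∪q∣≤∣p∣+∣q∣ p q)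
∣p∪q∣≤∣p∣+∣q∣ (false ∷ p) (true ∷ q)  = ≤-trans (s≤s (∣p∪q∣≤∣p∣+∣q∣ p q)) (≤-reflexive (≡.sym (+-suc ∣ p ∣ ∣ q ∣)))
∣p∪q∣≤∣p∣+∣q∣ (false ∷ p) (false ∷ q) = ∣p∪q∣≤∣p∣+∣q∣ p q

x∈p─q⇒x∉q : ∀ {n} (p q : Subset n) {x} → x ∈ p ─ q → x ∉ q
x∈p─q⇒x∉q (_ ∷ p) (false ∷ q) here       ()
x∈p─q⇒x∉q (_ ∷ p) (false ∷ q) (there x∈) (there x∈q) = x∈p─q⇒x∉q p q x∈ x∈q
x∈p─q⇒x∉q (_ ∷ p) (true ∷ q)  (there x∈) (there x∈q) = x∈p─q⇒x∉q p q x∈ x∈q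

p⊆q∧∣q∣≤∣p∣⇒q⊆p : ∀ {n} {p q : Subset n} → p ⊆ q → ∣ q ∣ ≤ ∣ p ∣ → q ⊆ p
p⊆q∧∣q∣≤∣p∣⇒q⊆p {p = p} p⊆q ∣q∣≤∣p∣ {x} x∈q with x ∈? p
... | yes x∈p = x∈p
... | no  x∉p = contradiction ∣q∣≤∣p∣ (<⇒≱ (p⊂q⇒∣p∣<∣q∣ (p⊆q , x , x∈q , x∉p)))

lookup≤foldr-⊔ : ∀ {a} {A : Set a} (f : A → ℕ) {k} (xs : Vec A k) (i : Fin k) →
                 f (lookup xs i) ≤ foldr (λ _ → ℕ) (λ x acc → f x ⊔ acc) 0 xs
lookup≤foldr-⊔ f (x ∷ xs) zero    = m≤m⊔n (f x) _
lookup≤foldr-⊔ f (x ∷ xs) (suc i) = ≤-trans (lookup≤foldr-⊔ f xs i) (m≤n⊔m (f x) _)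

Linked-last : ∀ {a ℓ} {A : Set a} {R : Rel A ℓ} {y : A} {l b} → Linked R (y ∷ l ++ [ b ]) →
              ∃[ z ] (z ∈ₗ y ∷ l × R z b)
Linked-last {y = y} {l = []}    (yb ∷ _)      = y , here refl , yb
Linked-last         {l = _ ∷ _} (_ ∷ path) with z , z∈ , zb ← Linked-last path = z , there z∈ , zb

Unique-rotate : ∀ {a} {A : Set a} {x : A} {l} → Unique (x ∷ l) → Unique (l ++ [ x ])
Unique-rotate (x∉l ∷ distinct) = AllPairs.++⁺ distinct ([] ∷ []) (All.map (λ x≢y → (x≢y ∘ ≡.sym) ∷ []) x∉l)

module _ {n} (G : Graph n) where

  nbhd : Fin n → Subset n
  nbhd v = tabulate (adj G v)

  closedNbhd : Fin n → Subset n
  closedNbhd v = ⁅ v ⁆ ∪ nbhd v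

  Adj-sym : ∀ {u v} → Adj G u v → Adj G v u
  Adj-sym {u} {v} uv = trans (Graph.sym G v u) uv

  Adj-irrefl : ∀ {v} → ¬ Adj G v v
  Adj-irrefl {v} vv with () ← trans (≡.sym vv) (Graph.irrefl G v)

  ∈closedNbhd⁺ : ∀ {u v} → Adj G v u → u ∈ closedNbhd v
  ∈closedNbhd⁺ vu = x∈p∪q⁺ (inj₂ (∈-tabulate⁺ vu))

  v∈closedNbhd : ∀ v → v ∈ closedNbhd v
  v∈closedNbhd v = x∈p∪q⁺ (inj₁ (x∈⁅x⁆ v))

  ∈closedNbhd⁻ : ∀ {u v} → u ∈ closedNbhd v → u ≡ v ⊎ Adj G v u
  ∈closedNbhd⁻ {u} {v} u∈ with x∈p∪q⁻ ⁅ v ⁆ (nbhd v) u∈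
  ... | inj₁ u∈⁅v⁆ = inj₁ (x∈⁅y⁆⇒x≡y v u∈⁅v⁆)
  ... | inj₂ u∈N   = inj₂ (∈-tabulate⁻ u∈N)

  degIn≡∣nbhd∩∣ : ∀ B v → degIn G B v ≡ ∣ nbhd v ∩ B ∣
  degIn≡∣nbhd∩∣ B v = begin
    countTrue (map (λ u → adj G v u ∧ lookup B u) (allFin n)) ≡⟨ cong countTrue (tabulate-allFin (λ u → adj G v u ∧ lookup B u)) ⟨
    countTrue (tabulate (λ u → adj G v u ∧ lookup B u))       ≡⟨ cong countTrue (tabulate-∧-lookup (adj G v) B) ⟩
    countTrue (nbhd v ∩ B)                                    ≡⟨ countTrue≡∣∣ (nbhd v ∩ B) ⟩
    ∣ nbhd v ∩ B ∣                                            ∎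
    where open ≡.≡-Reasoning

  deg≡∣nbhd∣ : ∀ v → deg G v ≡ ∣ nbhd v ∣
  deg≡∣nbhd∣ v = trans (degIn≡∣nbhd∩∣ ⊤ v) (cong ∣_∣ (∩-identityʳ (nbhd v)))

  deg≤maxDeg : ∀ v → deg G v ≤ maxDeg G
  deg≤maxDeg v = subst (λ u → deg G u ≤ maxDeg G) (lookup-allFin v) (lookup≤foldr-⊔ (deg G) (allFin n) v)

  ∣closedNbhd∣≤1+maxDeg : ∀ v → ∣ closedNbhd v ∣ ≤ suc (maxDeg G)
  ∣closedNbhd∣≤1+maxDeg v = begin
    ∣ ⁅ v ⁆ ∪ nbhd v ∣       ≤⟨ ∣p∪q∣≤∣p∣+∣q∣ ⁅ v ⁆ (nbhd v) ⟩
    ∣ ⁅ v ⁆ ∣ + ∣ nbhd v ∣   ≡⟨ cong₂ _+_ (∣⁅x⁆∣≡1 v) (≡.sym (deg≡∣nbhd∣ v)) ⟩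
    suc (deg G v)            ≤⟨ s≤s (deg≤maxDeg v) ⟩
    suc (maxDeg G)           ∎
    where open ≤-Reasoning

  maxDeg≤degIn⇒nbhd⊆ : ∀ {B v} → maxDeg G ≤ degIn G B v → nbhd v ⊆ B
  maxDeg≤degIn⇒nbhd⊆ {B} {v} Δ≤degIn =
    ⊆-trans (p⊆q∧∣q∣≤∣p∣⇒q⊆p (p∩q⊆p (nbhd v) B) ∣nbhd∣≤∣nbhd∩B∣) (p∩q⊆q (nbhd v) B)
    where
    open ≤-Reasoning
    ∣nbhd∣≤∣nbhd∩B∣ : ∣ nbhd v ∣ ≤ ∣ nbhd v ∩ B ∣
    ∣nbhd∣≤∣nbhd∩B∣ = begin
      ∣ nbhd v ∣      ≡⟨ deg≡∣nbhd∣ v ⟨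
      deg G v         ≤⟨ deg≤maxDeg v ⟩
      maxDeg G        ≤⟨ Δ≤degIn ⟩
      degIn G B v     ≡⟨ degIn≡∣nbhd∩∣ B v ⟩
      ∣ nbhd v ∩ B ∣  ∎

  no-closedNbhd⊆⇒InducedMaxDeg< : ∀ {B} → (∀ {v} → v ∈ B → ¬ closedNbhd v ⊆ B) → InducedMaxDeg< G B (maxDeg G)
  no-closedNbhd⊆⇒InducedMaxDeg< {B} notFull v v∈B with suc (degIn G B v) ≤? maxDeg G
  ... | yes small = small
  ... | no  large = ⊥-elim (notFull v∈B closedNbhd⊆B)
    where
    nbhd⊆B : nbhd v ⊆ B
    nbhd⊆B = maxDeg≤degIn⇒nbhd⊆ (s≤s⁻¹ (≰⇒> large))
    closedNbhd⊆B : closedNbhd v ⊆ B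
    closedNbhd⊆B {u} u∈ with x∈p∪q⁻ ⁅ v ⁆ (nbhd v) u∈
    ... | inj₁ u∈⁅v⁆ = subst (_∈ B) (≡.sym (x∈⁅y⁆⇒x≡y v u∈⁅v⁆)) v∈B
    ... | inj₂ u∈N   = nbhd⊆B u∈N

  WalkIn-mono : ∀ {P Q : Fin n → Set} → (∀ {x} → P x → Q x) → ∀ {a b} → WalkIn G P a b → WalkIn G Q a b
  WalkIn-mono P⇒Q (here pa)        = here (P⇒Q pa)
  WalkIn-mono P⇒Q (step pa ab walk) = step (P⇒Q pa) ab (WalkIn-mono P⇒Q walk)

  WalkIn-snoc : ∀ {P : Fin n → Set} {x y z} → WalkIn G P x y → Adj G y z → P z → WalkIn G P x z
  WalkIn-snoc (here px)        yz pz = step px yz (here pz)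
  WalkIn-snoc (step px xw walk) yz pz = step px xw (WalkIn-snoc walk yz pz)

  subsingleton⇒ConnectedOn : ∀ {P : Fin n → Set} → (∀ {x y} → P x → P y → x ≡ y) → ConnectedOn G P
  subsingleton⇒ConnectedOn {P} unique x y px py = subst (WalkIn G P x) (unique px py) (here px)

  Pendant : Fin n → Set
  Pendant x = ∀ {y z} → Adj G x y → Adj G x z → y ≡ z

  inner-¬Pendant : ∀ a l b {x} → Unique (a ∷ l ++ [ b ]) → Linked (Adj G) (a ∷ l ++ [ b ]) →
                   x ∈ₗ l → ¬ Pendant x
  inner-¬Pendant a (y ∷ [])    b ((_ ∷ a≢b ∷ _) ∷ _) (ay ∷ yb ∷ _) (here refl) pendant = a≢b (pendant (Adj-sym ay) yb)
  inner-¬Pendant a (y ∷ z ∷ l) b ((_ ∷ a≢z ∷ _) ∷ _) (ay ∷ yz ∷ _) (here refl) pendant = a≢z (pendant (Adj-sym ay) yz)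
  inner-¬Pendant a (y ∷ l)     b (_ ∷ distinct)      (_ ∷ path)    (there x∈l)         = inner-¬Pendant y l b distinct path x∈l

  Cycle-¬Pendant : (c : Cycle G) → ∀ {x} → x ∈ₗ Cycle.start c ∷ Cycle.rest c → ¬ Pendant x
  Cycle-¬Pendant record { rest = [] ; long = () }
  Cycle-¬Pendant record { rest = _ ∷ [] ; long = s≤s () }
  Cycle-¬Pendant record { start = s ; rest = r₁ ∷ r₂ ∷ r ; unique = _ ∷ r₁∉ ∷ _ ; linked = sr₁ ∷ cycle } (here refl) pendant
    with z , z∈ , zs ← Linked-last (Linked.tail cycle)
    = All.lookup r₁∉ z∈ (pendant sr₁ (Adj-sym zs))
  Cycle-¬Pendant record { start = s ; rest = r₁ ∷ r₂ ∷ r ; unique = (_ ∷ s≢r₂ ∷ _) ∷ _ ; linked = sr₁ ∷ r₁r₂ ∷ _ } (there (here refl)) pendant =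
    s≢r₂ (pendant (Adj-sym sr₁) r₁r₂)
  Cycle-¬Pendant record { start = s ; rest = r₁ ∷ r₂ ∷ r ; unique = distinct ; linked = _ ∷ path } (there (there x∈)) =
    inner-¬Pendant r₁ (r₂ ∷ r) s (Unique-rotate distinct) path x∈

module _ {k l} {G : Graph k} {H : Graph l} (f : Fin k → Fin l) (reflects : ∀ {a b} → Adj H (f a) (f b) → Adj G a b) where

  private
    preimages : ∀ {xs} → All (λ x → ∃[ a ] f a ≡ x) xs → ∃[ as ] List.map f as ≡ xs
    preimages []               = [] , refl
    preimages ((a , refl) ∷ ps) with as , refl ← preimages ps = a ∷ as , refl

  Cycle-pullback : (c : Cycle H) → All (λ x → ∃[ a ] f a ≡ x) (Cycle.start c ∷ Cycle.rest c) → Cycle G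
  Cycle-pullback record { long = long ; unique = unique ; linked = linked } ((s , refl) ∷ ps)
    with rs , refl ← preimages ps = record
    { start  = s
    ; rest   = rs
    ; long   = subst (2 ≤_) (length-map f rs) long
    ; unique = AllPairs.map (_∘ cong f) (AllPairs.map⁻ unique)
    ; linked = Linked.map reflects (Linked.map⁻ (subst (Linked (Adj H)) (cong (f s ∷_) (≡.sym (map-++ f rs [ s ]))) linked))
    }

module _ {n} (G : Graph n) {C : Fin n → Set} (C? : Decidable C) where

  record MaximalIndependentIn (U : List (Fin n)) : Set where
    field
      set         : Subset n
      ⊆C          : ∀ {v} → v ∈ set → C v
      independent : ∀ {u v} → u ∈ set → v ∈ set → ¬ Adj G u v
      maximal     : ∀ {u} → u ∈ₗ U → C u → u ∈ set ⊎ ∃[ w ] (w ∈ set × Adj G u w)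

  open MaximalIndependentIn

  private
    keep : ∀ {v U} (I : MaximalIndependentIn U) → (C v → v ∈ set I ⊎ ∃[ w ] (w ∈ set I × Adj G v w)) →
           MaximalIndependentIn (v ∷ U)
    keep I dominated = record
      { set = set I ; ⊆C = ⊆C I ; independent = independent I
      ; maximal = λ { (here refl) → dominated ; (there u∈U) → maximal I u∈U } }

    extend : ∀ v {U} → MaximalIndependentIn U → MaximalIndependentIn (v ∷ U)
    extend v I with C? v | nonempty? (nbhd G v ∩ set I)
    ... | no ¬Cv | _ = keep I (λ Cv → contradiction Cv ¬Cv)
    ... | yes _ | yes (w , w∈) = keep I (λ _ → inj₂ (w , p∩q⊆q _ (set I) w∈ , ∈-tabulate⁻ (p∩q⊆p _ (set I) w∈)))
    ... | yes Cv | no isolated = record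
      { set = ⁅ v ⁆ ∪ set I
      ; ⊆C = λ u∈ → [ (λ { refl → Cv }) , ⊆C I ]′ (member u∈)
      ; independent = λ u∈ w∈ → independent′ (member u∈) (member w∈)
      ; maximal = λ { (here refl) _ → inj₁ (x∈p∪q⁺ (inj₁ (x∈⁅x⁆ v)))
                    ; (there u∈U) Cu → Sum.map grown (Product.map₂ (Product.map₁ grown)) (maximal I u∈U Cu) } }
      where
      grown : set I ⊆ ⁅ v ⁆ ∪ set I
      grown = q⊆p∪q ⁅ v ⁆ (set I)
      member : ∀ {u} → u ∈ ⁅ v ⁆ ∪ set I → u ≡ v ⊎ u ∈ set I
      member u∈ = Sum.map₁ (x∈⁅y⁆⇒x≡y v) (x∈p∪q⁻ ⁅ v ⁆ (set I) u∈)
      no-nbhd-in-set : ∀ {w} → w ∈ set I → ¬ Adj G v w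
      no-nbhd-in-set w∈ vw = isolated (_ , x∈p∩q⁺ (∈-tabulate⁺ vw , w∈))
      independent′ : ∀ {u w} → u ≡ v ⊎ u ∈ set I → w ≡ v ⊎ w ∈ set I → ¬ Adj G u w
      independent′ (inj₁ refl) (inj₁ refl)    = Adj-irrefl G
      independent′ (inj₁ refl) (inj₂ w∈)   vw = no-nbhd-in-set w∈ vw
      independent′ (inj₂ u∈)   (inj₁ refl) uv = no-nbhd-in-set u∈ (Adj-sym G uv)
      independent′ (inj₂ u∈)   (inj₂ w∈)      = independent I u∈ w∈

  maximalIndependentIn : ∀ U → MaximalIndependentIn U
  maximalIndependentIn []      = record
    { set = ⊥ ; ⊆C = λ v∈ → contradiction v∈ ∉⊥ ; independent = λ u∈ → contradiction u∈ ∉⊥ ; maximal = λ () }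
  maximalIndependentIn (v ∷ U) = extend v (maximalIndependentIn U)

module AttachLeaves {m n} (T : Graph m) (parent : Fin n → Fin m) where

  data Node : Fin (m + n) → Set where
    old  : ∀ t → Node (t ↑ˡ n)
    leaf : ∀ i → Node (m ↑ʳ i)

  node : ∀ x → Node x
  node x with splitAt m x in eq
  ... | inj₁ t = subst Node (splitAt⁻¹-↑ˡ eq) (old t)
  ... | inj₂ i = subst Node (splitAt⁻¹-↑ʳ eq) (leaf i)

  private
    adjSplit : Fin m ⊎ Fin n → Fin m ⊎ Fin n → Bool
    adjSplit (inj₁ a) (inj₁ b) = adj T a b
    adjSplit (inj₁ a) (inj₂ j) = does (parent j ≟ a)
    adjSplit (inj₂ i) (inj₁ b) = does (parent i ≟ b)
    adjSplit (inj₂ _) (inj₂ _) = false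

    adjSplit-sym : ∀ x y → adjSplit x y ≡ adjSplit y x
    adjSplit-sym (inj₁ a) (inj₁ b) = Graph.sym T a b
    adjSplit-sym (inj₁ _) (inj₂ _) = refl
    adjSplit-sym (inj₂ _) (inj₁ _) = refl
    adjSplit-sym (inj₂ _) (inj₂ _) = refl

    adjSplit-irrefl : ∀ x → adjSplit x x ≡ false
    adjSplit-irrefl (inj₁ a) = Graph.irrefl T a
    adjSplit-irrefl (inj₂ _) = refl

  T⁺ : Graph (m + n)
  T⁺ = record
    { adj    = λ x y → adjSplit (splitAt m x) (splitAt m y)
    ; sym    = λ x y → adjSplit-sym (splitAt m x) (splitAt m y)
    ; irrefl = λ x → adjSplit-irrefl (splitAt m x)
    }

  adj-old-old : ∀ a b → adj T⁺ (a ↑ˡ n) (b ↑ˡ n) ≡ adj T a b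
  adj-old-old a b rewrite splitAt-↑ˡ m a n | splitAt-↑ˡ m b n = refl

  adj-leaf-old : ∀ i b → adj T⁺ (m ↑ʳ i) (b ↑ˡ n) ≡ does (parent i ≟ b)
  adj-leaf-old i b rewrite splitAt-↑ʳ m n i | splitAt-↑ˡ m b n = refl

  adj-leaf-leaf : ∀ i j → adj T⁺ (m ↑ʳ i) (m ↑ʳ j) ≡ false
  adj-leaf-leaf i j rewrite splitAt-↑ʳ m n i | splitAt-↑ʳ m n j = refl

  Adj-old : ∀ {a b} → Adj T a b → Adj T⁺ (a ↑ˡ n) (b ↑ˡ n)
  Adj-old {a} {b} = trans (adj-old-old a b)

  Adj-leaf-parent : ∀ i → Adj T⁺ (m ↑ʳ i) (parent i ↑ˡ n)
  Adj-leaf-parent i = trans (adj-leaf-old i (parent i)) (dec-true (parent i ≟ parent i) refl)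

  Adj-leaf⇒parent : ∀ {i} y → Adj T⁺ (m ↑ʳ i) y → y ≡ parent i ↑ˡ n
  Adj-leaf⇒parent {i} y iy with node y
  ... | leaf j with () ← trans (≡.sym (adj-leaf-leaf i j)) iy
  ... | old b with parent i ≟ b | trans (≡.sym (adj-leaf-old i b)) iy
  ...   | yes refl | _ = refl
  ...   | no  _    | ()

  leaf-Pendant : ∀ i → Pendant T⁺ (m ↑ʳ i)
  leaf-Pendant i {y} {z} iy iz = trans (Adj-leaf⇒parent y iy) (≡.sym (Adj-leaf⇒parent z iz))

  T⁺-acyclic : Acyclic T → Acyclic T⁺
  T⁺-acyclic acyclic c = acyclic (Cycle-pullback (_↑ˡ n) (trans (≡.sym (adj-old-old _ _))) c (All.tabulate old-vertex))
    where
    old-vertex : ∀ {x} → x ∈ₗ Cycle.start c ∷ Cycle.rest c → ∃[ t ] t ↑ˡ n ≡ x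
    old-vertex {x} x∈ with node x
    ... | old t  = t , refl
    ... | leaf i = ⊥-elim (Cycle-¬Pendant T⁺ c x∈ (leaf-Pendant i))

  module _ {P : Fin (m + n) → Set} where

    WalkIn-old : ∀ {a b} → WalkIn T (P ∘ (_↑ˡ n)) a b → WalkIn T⁺ P (a ↑ˡ n) (b ↑ˡ n)
    WalkIn-old (here pa)        = here pa
    WalkIn-old (step pa ab walk) = step pa (Adj-old ab) (WalkIn-old walk)

    ConnectedOn-T⁺ : ConnectedOn T (P ∘ (_↑ˡ n)) → (∀ i → P (m ↑ʳ i) → P (parent i ↑ˡ n)) → ConnectedOn T⁺ P
    ConnectedOn-T⁺ connected leaf⇒parent x y px py with node x | node y
    ... | old a  | old b  = WalkIn-old (connected a b px py)
    ... | old a  | leaf j = WalkIn-snoc T⁺ (WalkIn-old (connected a _ px (leaf⇒parent j py))) (Adj-sym T⁺ (Adj-leaf-parent j)) py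
    ... | leaf i | old b  = step px (Adj-leaf-parent i) (WalkIn-old (connected _ b (leaf⇒parent i px) py))
    ... | leaf i | leaf j = step px (Adj-leaf-parent i)
                              (WalkIn-snoc T⁺ (WalkIn-old (connected _ _ (leaf⇒parent i px) (leaf⇒parent j py)))
                                           (Adj-sym T⁺ (Adj-leaf-parent j)) py)

  T⁺-isTree : IsTree T → IsTree T⁺
  T⁺-isTree (nonempty , connected , acyclic) =
    ≤-trans nonempty (m≤m+n m n) , ConnectedOn-T⁺ connected (λ _ _ → tt) , T⁺-acyclic acyclic

module LeafRefinement {n} {G : Graph n} (D : TreeDecomposition G) (S : Subset n)
  (S-independent : ∀ {u v} → u ∈ S → v ∈ S → ¬ Adj G u v)
  (host : Fin n → Fin (nodes D))
  (host-covers : ∀ {v} → v ∈ S → closedNbhd G v ⊆ bag D (host v)) where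

  open AttachLeaves (tree D) host

  oldBag : Fin (nodes D) → Subset n
  oldBag t = bag D t ─ S

  -- Every vertex gets a leaf, so that leaves are indexed by Fin n; the leaf of v ∉ S has an empty bag.
  leafBag : Fin n → Subset n
  leafBag v with v ∈? S
  ... | yes _ = closedNbhd G v
  ... | no  _ = ⊥

  bags : Fin (nodes D + n) → Subset n
  bags = oldBag Vector.++ leafBag

  ∈old⁺ : ∀ {u t} → u ∈ bag D t → u ∉ S → u ∈ bags (t ↑ˡ n)
  ∈old⁺ {u} {t} u∈t u∉S = subst (u ∈_) (≡.sym (lookup-++ˡ oldBag leafBag t)) (x∈p∧x∉q⇒x∈p─q u∈t u∉S)

  ∈old⁻ : ∀ {u t} → u ∈ bags (t ↑ˡ n) → u ∈ bag D t × u ∉ S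
  ∈old⁻ {u} {t} u∈ = p─q⊆p _ S u∈old , x∈p─q⇒x∉q (bag D t) S u∈old
    where
    u∈old : u ∈ oldBag t
    u∈old = subst (u ∈_) (lookup-++ˡ oldBag leafBag t) u∈

  ∈leaf⁺ : ∀ {u v} → v ∈ S → u ∈ closedNbhd G v → u ∈ bags (nodes D ↑ʳ v)
  ∈leaf⁺ {u} {v} v∈S u∈N = subst (u ∈_) (≡.sym (lookup-++ʳ oldBag leafBag v)) (∈leafBag v∈S u∈N)
    where
    ∈leafBag : v ∈ S → u ∈ closedNbhd G v → u ∈ leafBag v
    ∈leafBag v∈S u∈N with v ∈? S
    ... | yes _   = u∈N
    ... | no v∉S = contradiction v∈S v∉S

  ∈leaf⁻ : ∀ {u v} → u ∈ bags (nodes D ↑ʳ v) → v ∈ S × u ∈ closedNbhd G v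
  ∈leaf⁻ {u} {v} u∈ = leafBag⁻ (subst (u ∈_) (lookup-++ʳ oldBag leafBag v) u∈)
    where
    leafBag⁻ : u ∈ leafBag v → v ∈ S × u ∈ closedNbhd G v
    leafBag⁻ u∈ with v ∈? S
    ... | yes v∈S = v∈S , u∈
    ... | no  _   = contradiction u∈ ∉⊥

  covers′ : ∀ v → ∃[ x ] v ∈ bags x
  covers′ v with v ∈? S
  ... | yes v∈S = _ , ∈leaf⁺ v∈S (v∈closedNbhd G v)
  ... | no  v∉S with t , v∈t ← covers D v = _ , ∈old⁺ v∈t v∉S

  edges′ : ∀ u v → Adj G u v → ∃[ x ] (u ∈ bags x × v ∈ bags x)
  edges′ u v uv with u ∈? S | v ∈? S
  ... | yes u∈S | _       = _ , ∈leaf⁺ u∈S (v∈closedNbhd G u) , ∈leaf⁺ u∈S (∈closedNbhd⁺ G uv)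
  ... | no  _   | yes v∈S = _ , ∈leaf⁺ v∈S (∈closedNbhd⁺ G (Adj-sym G uv)) , ∈leaf⁺ v∈S (v∈closedNbhd G v)
  ... | no  u∉S | no  v∉S with t , u∈t , v∈t ← edges D u v uv = _ , ∈old⁺ u∈t u∉S , ∈old⁺ v∈t v∉S

  ∈S⇒only-own-leaf : ∀ {w x} → w ∈ S → w ∈ bags x → x ≡ nodes D ↑ʳ w
  ∈S⇒only-own-leaf {w} {x} w∈S w∈x with node x
  ... | old t  = contradiction w∈S (proj₂ (∈old⁻ w∈x))
  ... | leaf v with v∈S , w∈N ← ∈leaf⁻ w∈x with ∈closedNbhd⁻ G w∈N
  ...   | inj₁ refl = refl
  ...   | inj₂ vw   = contradiction vw (S-independent v∈S w∈S)

  coherent′ : ∀ w → ConnectedOn T⁺ (λ x → w ∈ bags x)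
  coherent′ w with w ∈? S
  ... | yes w∈S = subsingleton⇒ConnectedOn T⁺ λ w∈x w∈y →
                    trans (∈S⇒only-own-leaf w∈S w∈x) (≡.sym (∈S⇒only-own-leaf w∈S w∈y))
  ... | no  w∉S = ConnectedOn-T⁺ old-connected leaf⇒host
    where
    old-connected : ConnectedOn (tree D) (λ t → w ∈ bags (t ↑ˡ n))
    old-connected a b w∈a w∈b =
      WalkIn-mono (tree D) (λ w∈t → ∈old⁺ w∈t w∉S) (coherent D w a b (proj₁ (∈old⁻ w∈a)) (proj₁ (∈old⁻ w∈b)))
    leaf⇒host : ∀ v → w ∈ bags (nodes D ↑ʳ v) → w ∈ bags (host v ↑ˡ n)
    leaf⇒host v w∈v with v∈S , w∈N ← ∈leaf⁻ w∈v = ∈old⁺ (host-covers v∈S w∈N) w∉S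

  refinement : TreeDecomposition G
  refinement = record
    { nodes    = nodes D + n
    ; tree     = T⁺
    ; isTree   = T⁺-isTree (isTree D)
    ; bag      = bags
    ; covers   = covers′
    ; edges    = edges′
    ; coherent = coherent′
    }

  bags⊆old-bag : ∀ x → ∃[ t ] bags x ⊆ bag D t
  bags⊆old-bag x with node x
  ... | old t  = t , proj₁ ∘ ∈old⁻
  ... | leaf v = host v , λ u∈ → let v∈S , u∈N = ∈leaf⁻ u∈ in host-covers v∈S u∈N

  refinement-BagsAtMost : ∀ {s} → BagsAtMost D s → BagsAtMost refinement s
  refinement-BagsAtMost small x with t , ⊆t ← bags⊆old-bag x = ≤-trans (p⊆q⇒∣p∣≤∣q∣ ⊆t) (small t)

  ∣leaf∣≤1+maxDeg : ∀ v → ∣ bags (nodes D ↑ʳ v) ∣ ≤ suc (maxDeg G)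
  ∣leaf∣≤1+maxDeg v = ≤-trans (p⊆q⇒∣p∣≤∣q∣ (proj₂ ∘ ∈leaf⁻)) (∣closedNbhd∣≤1+maxDeg G v)

module DegreeRefinement {n} {G : Graph n} (D : TreeDecomposition G) where

  Hosted : Fin n → Set
  Hosted v = ∃[ t ] closedNbhd G v ⊆ bag D t

  hosted? : Decidable Hosted
  hosted? v = any? (λ t → closedNbhd G v ⊆? bag D t)

  -- Any node will do for unhosted vertices: they are not in S, so their leaves are empty.
  host : Fin n → Fin (nodes D)
  host v with hosted? v
  ... | yes (t , _) = t
  ... | no  _       = fromℕ< (proj₁ (isTree D))

  host-covers : ∀ {v} → Hosted v → closedNbhd G v ⊆ bag D (host v)
  host-covers {v} hosted with hosted? v
  ... | yes (_ , N⊆t) = N⊆t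
  ... | no  unhosted  = contradiction hosted unhosted

  open MaximalIndependentIn (maximalIndependentIn G hosted? (List.allFin n))
  open AttachLeaves (tree D) host using (node; old; leaf)
  open LeafRefinement D set independent host (host-covers ∘ ⊆C) public

  old-InducedMaxDeg< : ∀ t → InducedMaxDeg< G (bags (t ↑ˡ n)) (maxDeg G)
  old-InducedMaxDeg< t = no-closedNbhd⊆⇒InducedMaxDeg< G full⇒⊥
    where
    full⇒⊥ : ∀ {u} → u ∈ bags (t ↑ˡ n) → ¬ closedNbhd G u ⊆ bags (t ↑ˡ n)
    full⇒⊥ {u} u∈ N⊆ with maximal (∈-allFin u) (t , proj₁ ∘ ∈old⁻ ∘ N⊆)
    ... | inj₁ u∈S            = proj₂ (∈old⁻ u∈) u∈S
    ... | inj₂ (w , w∈S , uw) = proj₂ (∈old⁻ (N⊆ (∈closedNbhd⁺ G uw))) w∈S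

  refinement-bags : ∀ x → InducedMaxDeg< G (bags x) (maxDeg G) ⊎ ∣ bags x ∣ ≤ suc (maxDeg G)
  refinement-bags x with node x
  ... | old t  = inj₁ (old-InducedMaxDeg< t)
  ... | leaf v = inj₂ (∣leaf∣≤1+maxDeg v)

proposition11 : ∀ {n} (G : Graph n) (twPlusOne : ℕ) → IsTreewidthPlusOne G twPlusOne →
    ∃[ D ] (BagsAtMost {G = G} D twPlusOne ×
      (∀ t → InducedMaxDeg< G (bag D t) (maxDeg G) ⊎ ∣ bag D t ∣ ≤ suc (maxDeg G)))
proposition11 G _ ((D , D-small) , _) = refinement , refinement-BagsAtMost D-small , refinement-bags
  where open DegreeRefinement D
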